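{- Let $k\ge1$ be an integer and define the sequence $(r_n)_{n\ge0}$ over $\mathbb{F}_2$ by $r_0=0$ and, for $n\ge1$, $$r_n=\begin{cases} r_{\lfloor n/2\rfloor}+1 & \text{if } n\equiv 2^k-1 \pmod{2^k},\\ r_{\lfloor n/2\rfloor} & \text{otherwise}\end{cases}$$ (the parity of the number of occurrences of the block $11\dots1$ of length $k$ in the binary expansion of $n$; $k=1$ gives the Thue--Morse sequence, $k=2$ the Rudin--Shapiro sequence). Then for every $N\ge1$, $$L(r_n,N)=\begin{cases} 2(2^k-1)\left\lfloor\frac{N}{4(2^k-1)}\right\rfloor+2^k & \text{if } 2^k\le N \bmod 4(2^k-1)\le 3(2^k-1),\\[4pt] 2(2^k-1)\left\lfloor\frac{N+2^k-2}{4(2^k-1)}\right\rfloor & \text{otherwise.}\end{cases}$$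
   Context: The $N$th linear complexity $L(u_n,N)$ of a sequence $(u_n)$ over $\mathbb{F}_2$ is the least $L\ge 0$ such that there exist $c_0,\dots,c_{L-1}\in\mathbb{F}_2$ with $u_{n+L}=c_{L-1}u_{n+L-1}+\dots+c_0u_n$ for all $0\le n\le N-L-1$; by convention $L(u_n,N)=0$ if $u_0=\dots=u_{N-1}=0$, and $L(u_n,N)=N$ if $u_0=\dots=u_{N-2}=0\ne u_{N-1}$. Here $N \bmod 4(2^k-1)$ denotes the least nonnegative residue. -}

module Defs where

open import Data.Nat using (ℕ; zero; suc; _+_; _*_; _∸_; _^_; _≤_; _<_; s≤s; z≤n; NonZero; >-nonZero; _/_; _%_; _≟_)
open import Data.Nat.Properties using (≤-trans; m≤m*n; *-monoʳ-≤; ∸-monoˡ-≤; ^-monoʳ-≤; ≤-refl)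
open import Data.Bool using (Bool; true; false; _xor_; _∧_)
open import Data.Fin using (Fin; toℕ)
open import Data.Product using (Σ; _×_)
open import Relation.Binary.PropositionalEquality using (_≡_)
open import Relation.Nullary.Decidable using (⌊_⌋)

-- Sequences over F₂ are modelled as ℕ → Bool (false = 0, true = 1,
-- addition = _xor_, multiplication = _∧_).

xsum : (L : ℕ) → (Fin L → Bool) → Bool
xsum zero    f = false
xsum (suc L) f = f Fin.zero xor xsum L (λ i → f (Fin.suc i))

HasRecurrence : (ℕ → Bool) → ℕ → ℕ → Set
HasRecurrence u N L =
  Σ (Fin L → Bool) λ c →
    ∀ n → n + L < N → u (n + L) ≡ xsum L (λ i → c i ∧ u (n + toℕ i))

-- L(u, N) = L : L is the least length of such a recurrence.
-- (The conventions L = 0 for an all-zero prefix and L = N for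
--  0 … 0 1 are the instances of this definition with an empty sum /
--  a vacuous condition.)
IsLinearComplexity : (ℕ → Bool) → ℕ → ℕ → Set
IsLinearComplexity u N L =
  HasRecurrence u N L × (∀ L′ → HasRecurrence u N L′ → L ≤ L′)

-- The sequence r (depending on k):  r₀ = 0,
--   r_n = r_{⌊n/2⌋} + 1  if n ≡ 2^k - 1 (mod 2^k),   r_{⌊n/2⌋} otherwise.
-- Implemented with fuel; fuel n suffices for argument n since ⌊n/2⌋ < n.

2^k-nonZero : ∀ k → NonZero (2 ^ k)
2^k-nonZero k = m^n≢0 2 k
  where open import Data.Nat.Properties using (m^n≢0)

rFuel : (k : ℕ) → ℕ → ℕ → Bool
rFuel k zero       n       = false
rFuel k (suc fuel) zero    = false
rFuel k (suc fuel) (suc m) =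
  ⌊ (_%_ (suc m) (2 ^ k) {{2^k-nonZero k}}) ≟ (2 ^ k ∸ 1) ⌋
    xor rFuel k fuel (suc m / 2)

r : (k : ℕ) → ℕ → Bool
r k n = rFuel k n n

period : ℕ → ℕ
period k = 4 * (2 ^ k ∸ 1)

period-nonZero : ∀ k → 1 ≤ k → NonZero (period k)
period-nonZero (suc k) _ = >-nonZero (≤-trans (s≤s z≤n) (≤-trans step (m≤m*n′)))
  where
  open import Data.Nat.Properties using (m≤n*m)
  step : 1 ≤ 2 ^ suc k ∸ 1
  step = ∸-monoˡ-≤ 1 (^-monoʳ-≤ 2 {1} {suc k} (s≤s z≤n))
  m≤m*n′ : 2 ^ suc k ∸ 1 ≤ 4 * (2 ^ suc k ∸ 1)
  m≤m*n′ = m≤n*m (2 ^ suc k ∸ 1) 4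

open import Data.Bool using (if_then_else_)
open import Data.Nat using (_≤ᵇ_)

LFormula : (k : ℕ) → 1 ≤ k → ℕ → ℕ
LFormula k k≥1 N =
  if (2 ^ k ≤ᵇ N % period k) ∧ (N % period k ≤ᵇ 3 * (2 ^ k ∸ 1))
  then 2 * (2 ^ k ∸ 1) * (N / period k) + 2 ^ k
  else 2 * (2 ^ k ∸ 1) * ((N + 2 ^ k ∸ 2) / period k)
  where instance _ = period-nonZero k k≥1

module Submission where

-- Linear complexity profile of r, the parity of the number of blocks of k
-- ones in the binary expansion of n.  Let K = 2^k − 1.
--
-- For a polynomial p over F₂ let (p ⋆ u) n = Σ pᵢ u (n + i).  A generator of
-- u of length L and range A is a monic p of degree L with p ⋆ u vanishing
-- below A but not at A.  It gives L(u, N) ≤ L for N ≤ A + L and, by Massey's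
-- lemma, L(u, N) > A for N > A + L; so consecutive generators of lengths L
-- and A + 1 determine L(u, N) on a whole window.
--
-- Generators of r are obtained in three steps.  (1) Let s n = 1 iff
-- n = K · 2^e; by Lucas' theorem r is the binomial transform of s, and
-- p ↦ p (x + 1) turns generators of s into generators of r.  (2) Along the
-- multiples of K, s is the indicator f of the powers of two; monic
-- polynomials D n of degree n annihilating f exactly on 1 … n are built by a
-- doubling recursion.  (3) Spreading D n along the multiples of K yields
-- generators of s failing at (4q + 1) K and (4q + 3) K; the resulting
-- staircase is the closed formula.

open import Defs
open import Data.Nat
  using (ℕ; zero; suc; pred; _+_; _*_; _∸_; _^_; _≤_; _<_; _≤?_; _≤ᵇ_; _≟_; s≤s; z≤n; ⌊_/2⌋; _/_; _%_; NonZero)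
open import Data.Nat.Properties
  using (+-assoc; +-comm; +-identityʳ; +-suc; *-comm; *-distribʳ-+; suc-injective;
         ≤-refl; ≤-reflexive; ≤-trans; ≤-antisym; ≤-pred; <-trans; ≤-<-trans; <-≤-trans;
         <⇒≤; <⇒≢; <⇒≱; ≰⇒>; ≤∧≢⇒<; n≤1+n; m<n⇒m<1+n; m≤m+n; m≤n+m; m<m+n;
         +-mono-≤; +-mono-<; +-monoˡ-≤; +-monoʳ-≤; +-monoˡ-<; +-monoʳ-<; +-cancelʳ-<; *-cancelʳ-<;
         m∸n+n≡m; m^n>0; ≤ᵇ⇒≤; ≤⇒≤ᵇ; n≡⌊n+n/2⌋; ⌊n/2⌋<n; module ≤-Reasoning)
open import Data.Nat.DivMod
  using (m≡m%n+[m/n]*n; [m+kn]%n≡m%n; m<n⇒m%n≡m; +-distrib-/; m<n⇒m/n≡0; m*n%n≡0; m*n/n≡m; m%n<n; n%1≡0)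
open import Data.Nat.Induction using (<-rec)
open import Data.Nat.Tactic.RingSolver using (solve-∀)
open import Data.Bool using (Bool; true; false; not; T; _xor_; _∧_; if_then_else_)
open import Data.Bool.Properties
  using (∧-identityʳ; ∧-distribˡ-xor; ∧-distribʳ-xor; not-involutive; xor-assoc; xor-comm;
         xor-identityʳ; xor-inverseˡ; xor-annihilates-not)
open import Data.Bool.Solver using (module xor-∧-Solver)
open import Data.Unit using (tt)
open import Data.List using (List; []; _∷_; length; replicate; _++_)
open import Data.Fin using (Fin; toℕ)
import Data.Fin as Fin
open import Data.Fin.Properties using (toℕ<n)
open import Data.Product using (Σ; _×_; _,_)
open import Data.Empty using (⊥-elim)
open import Relation.Nullary using (¬_; yes; no)
open import Relation.Nullary.Decidable using (⌊_⌋; isYes≗does; dec-true; dec-false; toWitness)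
open import Relation.Binary.PropositionalEquality

xor-interchange : ∀ a b c d → (a xor b) xor (c xor d) ≡ (a xor c) xor (b xor d)
xor-interchange = solve 4 (λ a b c d → (a :+ b) :+ (c :+ d) := (a :+ c) :+ (b :+ d)) refl
  where open xor-∧-Solver

xsum-cong : ∀ L {f g : Fin L → Bool} → (∀ i → f i ≡ g i) → xsum L f ≡ xsum L g
xsum-cong zero    eq = refl
xsum-cong (suc L) eq = cong₂ _xor_ (eq Fin.zero) (xsum-cong L (λ i → eq (Fin.suc i)))

xsum-zero : ∀ L → xsum L (λ _ → false) ≡ false
xsum-zero zero    = refl
xsum-zero (suc L) = xsum-zero L

xsum-xor : ∀ L (f g : Fin L → Bool) →
           xsum L (λ i → f i xor g i) ≡ xsum L f xor xsum L g
xsum-xor zero    f g = refl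
xsum-xor (suc L) f g =
  trans (cong ((f Fin.zero xor g Fin.zero) xor_) (xsum-xor L _ _))
        (xor-interchange (f Fin.zero) (g Fin.zero) _ _)

xsum-scale : ∀ L b (f : Fin L → Bool) → b ∧ xsum L f ≡ xsum L (λ i → b ∧ f i)
xsum-scale zero    false f = refl
xsum-scale zero    true  f = refl
xsum-scale (suc L) b     f =
  trans (∧-distribˡ-xor b _ _) (cong ((b ∧ f Fin.zero) xor_) (xsum-scale L b _))

xsum-swap : ∀ L M (h : Fin L → Fin M → Bool) →
  xsum L (λ i → xsum M (λ j → h i j)) ≡ xsum M (λ j → xsum L (λ i → h i j))
xsum-swap zero    M h = sym (xsum-zero M)
xsum-swap (suc L) M h =
  trans (cong (xsum M (h Fin.zero) xor_) (xsum-swap L M (λ i → h (Fin.suc i))))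
        (sym (xsum-xor M (h Fin.zero) (λ j → xsum L (λ i → h (Fin.suc i) j))))

+-swapʳ : ∀ a b c → a + b + c ≡ a + c + b
+-swapʳ = solve-∀

RecursAt : (u : ℕ → Bool) {L : ℕ} → (Fin L → Bool) → ℕ → Set
RecursAt u {L} c n = u (n + L) ≡ xsum L (λ i → c i ∧ u (n + toℕ i))

-- Massey's lemma: if a recurrence of length L holds at all offsets < A
-- but fails at offset A (so it generates exactly the first A + L terms),
-- then every recurrence generating the first A + L + 1 terms is longer
-- than A.  Otherwise the two recurrences together would predict u (A + L)
-- correctly with c.
massey : ∀ (u : ℕ → Bool) {L L′} (c : Fin L → Bool) (d : Fin L′ → Bool) A →
         (∀ n → n < A → RecursAt u c n) → ¬ RecursAt u c A →
         (∀ n → n + L′ ≤ A + L → RecursAt u d n) → suc A ≤ L′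
massey u {L} {L′} c d A c-holds c-fails d-holds with suc A ≤? L′
... | yes A<L′ = A<L′
... | no  A≮L′ = ⊥-elim (c-fails c-holds-at-A)
  where
  B : ℕ
  B = A ∸ L′
  A≡B+L′ : A ≡ B + L′
  A≡B+L′ = sym (m∸n+n≡m (≤-pred (≰⇒> A≮L′)))

  d-expands-window : ∀ (i : Fin L) →
    u (A + toℕ i) ≡ xsum L′ (λ j → d j ∧ u (B + toℕ i + toℕ j))
  d-expands-window i = trans (cong u idx) (d-holds (B + toℕ i) bound)
    where
    idx : A + toℕ i ≡ B + toℕ i + L′
    idx = trans (cong (_+ toℕ i) A≡B+L′) (+-swapʳ B L′ (toℕ i))
    bound : B + toℕ i + L′ ≤ A + L
    bound = subst (_≤ A + L) idx (+-monoʳ-≤ A (<⇒≤ (toℕ<n i)))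

  c-expands-window : ∀ (j : Fin L′) →
    u (B + L + toℕ j) ≡ xsum L (λ i → c i ∧ u (B + toℕ j + toℕ i))
  c-expands-window j = trans (cong u (+-swapʳ B L (toℕ j))) (c-holds (B + toℕ j) bound)
    where
    bound : B + toℕ j < A
    bound = subst (B + toℕ j <_) (sym A≡B+L′) (+-monoʳ-< B (toℕ<n j))

  c-holds-at-A : RecursAt u c A
  c-holds-at-A = begin
    u (A + L)
      ≡⟨ cong u (trans (cong (_+ L) A≡B+L′) (+-swapʳ B L′ L)) ⟩
    u (B + L + L′)
      ≡⟨ d-holds (B + L) (≤-reflexive (trans (+-swapʳ B L L′) (cong (_+ L) (sym A≡B+L′)))) ⟩
    xsum L′ (λ j → d j ∧ u (B + L + toℕ j))
      ≡⟨ xsum-cong L′ (λ j → trans (cong (d j ∧_) (c-expands-window j)) (xsum-scale L (d j) _)) ⟩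
    xsum L′ (λ j → xsum L (λ i → d j ∧ (c i ∧ u (B + toℕ j + toℕ i))))
      ≡⟨ sym (xsum-swap L L′ _) ⟩
    xsum L (λ i → xsum L′ (λ j → d j ∧ (c i ∧ u (B + toℕ j + toℕ i))))
      ≡⟨ xsum-cong L (λ i → xsum-cong L′ (λ j → reorder (c i) (d j) (toℕ i) (toℕ j))) ⟩
    xsum L (λ i → xsum L′ (λ j → c i ∧ (d j ∧ u (B + toℕ i + toℕ j))))
      ≡⟨ xsum-cong L (λ i → trans (sym (xsum-scale L′ (c i) _)) (cong (c i ∧_) (sym (d-expands-window i)))) ⟩
    xsum L (λ i → c i ∧ u (A + toℕ i)) ∎
    where
    open ≡-Reasoning
    reorder : ∀ a b x y → b ∧ (a ∧ u (B + y + x)) ≡ a ∧ (b ∧ u (B + x + y))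
    reorder a b x y =
      trans (cong (λ t → b ∧ (a ∧ u t)) (+-swapʳ B y x)) (∧-swap b a _)
      where
      ∧-swap : ∀ p q r → p ∧ (q ∧ r) ≡ q ∧ (p ∧ r)
      ∧-swap = solve 3 (λ p q r → p :* (q :* r) := q :* (p :* r)) refl
        where open xor-∧-Solver

-- Polynomials over F₂, as coefficient lists starting with the constant term.
Poly : Set
Poly = List Bool

infixl 6 _⊕_
_⊕_ : Poly → Poly → Poly
[]      ⊕ q       = q
(a ∷ p) ⊕ []      = a ∷ p
(a ∷ p) ⊕ (b ∷ q) = (a xor b) ∷ (p ⊕ q)

-- A polynomial p = Σ pᵢ xⁱ acts on sequences with x as the shift:
-- (p ⋆ u) n = Σ pᵢ u (n + i).
_⋆_ : Poly → (ℕ → Bool) → ℕ → Bool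
([]      ⋆ u) n = false
((b ∷ p) ⋆ u) n = (b ∧ u n) xor (p ⋆ u) (suc n)

⊕-⋆ : ∀ p q u n → ((p ⊕ q) ⋆ u) n ≡ (p ⋆ u) n xor (q ⋆ u) n
⊕-⋆ []      q       u n = refl
⊕-⋆ (a ∷ p) []      u n = sym (xor-identityʳ _)
⊕-⋆ (a ∷ p) (b ∷ q) u n =
  trans (cong₂ _xor_ (∧-distribʳ-xor (u n) a b) (⊕-⋆ p q u (suc n)))
        (xor-interchange (a ∧ u n) (b ∧ u n) _ _)

⋆-vanishes : ∀ p {u} n → (∀ m → n ≤ m → u m ≡ false) → (p ⋆ u) n ≡ false
⋆-vanishes []          n u≡0 = refl
⋆-vanishes (false ∷ p) n u≡0 = ⋆-vanishes p (suc n) (λ m n<m → u≡0 m (<⇒≤ n<m))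
⋆-vanishes (true  ∷ p) n u≡0
  rewrite u≡0 n ≤-refl = ⋆-vanishes p (suc n) (λ m n<m → u≡0 m (<⇒≤ n<m))

shift : ℕ → Poly → Poly
shift a q = replicate a false ++ q

shift-⋆ : ∀ a q u n → (shift a q ⋆ u) n ≡ (q ⋆ u) (n + a)
shift-⋆ zero    q u n = cong (q ⋆ u) (sym (+-identityʳ n))
shift-⋆ (suc a) q u n = trans (shift-⋆ a q u (suc n)) (cong (q ⋆ u) (sym (+-suc n a)))

-- spread a p = p (x^(a+1)).  Acting on u it acts on the subsequence of u
-- along an arithmetic progression of difference a + 1.
spread : ℕ → Poly → Poly
spread a []          = []
spread a (b ∷ [])    = b ∷ []
spread a (b ∷ c ∷ p) = b ∷ shift a (spread a (c ∷ p))

spread-⋆ : ∀ a p u v ρ → (∀ t → v t ≡ u (t * suc a + ρ)) →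
           ∀ i → (spread a p ⋆ u) (i * suc a + ρ) ≡ (p ⋆ v) i
spread-⋆ a []          u v ρ v≡ i = refl
spread-⋆ a (b ∷ [])    u v ρ v≡ i = cong (λ x → (b ∧ x) xor false) (sym (v≡ i))
spread-⋆ a (b ∷ c ∷ p) u v ρ v≡ i =
  cong₂ _xor_ (cong (b ∧_) (sym (v≡ i)))
    (begin
      (shift a (spread a (c ∷ p)) ⋆ u) (suc (i * suc a + ρ))
        ≡⟨ shift-⋆ a (spread a (c ∷ p)) u _ ⟩
      (spread a (c ∷ p) ⋆ u) (suc (i * suc a + ρ) + a)
        ≡⟨ cong (spread a (c ∷ p) ⋆ u) (next-term i a ρ) ⟩
      (spread a (c ∷ p) ⋆ u) (suc i * suc a + ρ)
        ≡⟨ spread-⋆ a (c ∷ p) u v ρ v≡ (suc i) ⟩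
      ((c ∷ p) ⋆ v) (suc i) ∎)
  where
  open ≡-Reasoning
  next-term : ∀ i a ρ → suc (i * suc a + ρ) + a ≡ suc i * suc a + ρ
  next-term = solve-∀

data Monic : ℕ → Poly → Set where
  monic-one : Monic 0 (true ∷ [])
  monic-∷   : ∀ {n b p} → Monic n p → Monic (suc n) (b ∷ p)

Monic-length : ∀ {n p} → Monic n p → length p ≡ suc n
Monic-length monic-one   = refl
Monic-length (monic-∷ m) = cong suc (Monic-length m)

Monic-⊕ : ∀ {n p} q → Monic n p → length q ≤ n → Monic n (p ⊕ q)
Monic-⊕ []      monic-one   _         = monic-one
Monic-⊕ []      (monic-∷ m) _         = monic-∷ m
Monic-⊕ (x ∷ q) (monic-∷ m) (s≤s q<n) = monic-∷ (Monic-⊕ q m q<n)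

Monic-shift : ∀ {n p} a → Monic n p → Monic (a + n) (shift a p)
Monic-shift zero    m = m
Monic-shift (suc a) m = monic-∷ (Monic-shift a m)

Monic-spread : ∀ {n p} a → Monic n p → Monic (n * suc a) (spread a p)
Monic-spread a monic-one               = monic-one
Monic-spread a (monic-∷ {p = _ ∷ _} m) = monic-∷ (Monic-shift a (Monic-spread a m))

monic-coefficients : ∀ {L p} → Monic L p → Σ (Fin L → Bool) λ c →
  ∀ u n → (p ⋆ u) n ≡ xsum L (λ i → c i ∧ u (n + toℕ i)) xor u (n + L)
monic-coefficients monic-one =
  (λ ()) , λ u n → trans (xor-identityʳ (u n)) (cong u (sym (+-identityʳ n)))
monic-coefficients {suc L} (monic-∷ {b = b} m) with monic-coefficients m
... | c , defect = (λ { Fin.zero → b ; (Fin.suc i) → c i }) , λ u n →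
  trans (cong ((b ∧ u n) xor_) (defect u (suc n)))
    (trans (sym (xor-assoc (b ∧ u n) _ _))
      (cong₂ _xor_
        (cong₂ (λ x y → (b ∧ u x) xor y) (sym (+-identityʳ n))
               (xsum-cong L (λ i → cong (λ x → c i ∧ u x) (sym (+-suc n (toℕ i))))))
        (cong u (sym (+-suc n L)))))

record Generator (u : ℕ → Bool) (L A : ℕ) : Set where
  field
    poly     : Poly
    monic    : Monic L poly
    vanishes : ∀ n → n < A → (poly ⋆ u) n ≡ false
    fails    : (poly ⋆ u) A ≡ true

xor≡false⇒≡ : ∀ a b → a xor b ≡ false → b ≡ a
xor≡false⇒≡ false b    eq = eq
xor≡false⇒≡ true  true eq = refl

xor≡true⇒≢ : ∀ a b → a xor b ≡ true → ¬ (b ≡ a)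
xor≡true⇒≢ false false () refl
xor≡true⇒≢ true  true  () refl

generator-recurrence : ∀ {u L A} → Generator u L A → Σ (Fin L → Bool) λ c →
  (∀ n → n < A → RecursAt u c n) × ¬ RecursAt u c A
generator-recurrence {u} {L} {A} G with monic-coefficients (Generator.monic G)
... | c , defect =
  c , (λ n n<A → xor≡false⇒≡ _ _ (trans (sym (defect u n)) (Generator.vanishes G n n<A)))
    , xor≡true⇒≢ _ _ (trans (sym (defect u A)) (Generator.fails G))

generator-upper : ∀ {u L A} → Generator u L A → ∀ N → N ≤ A + L → HasRecurrence u N L
generator-upper {L = L} {A} G N N≤A+L with generator-recurrence G
... | c , recurs , _ = c , λ n n+L<N → recurs n (+-cancelʳ-< L n A (≤-trans n+L<N N≤A+L))

generator-lower : ∀ {u L A} → Generator u L A → ∀ N → A + L < N →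
                  ∀ L′ → HasRecurrence u N L′ → suc A ≤ L′
generator-lower {u} {L} {A} G N A+L<N L′ (d , d-holds) with generator-recurrence G
... | c , recurs , fails =
  massey u c d A recurs fails (λ n n+L′≤A+L → d-holds n (≤-<-trans n+L′≤A+L A+L<N))

complexity-between : ∀ {u L A A′} → Generator u L A → Generator u (suc A) A′ →
  ∀ N → A + L < N → N ≤ A′ + suc A → IsLinearComplexity u N (suc A)
complexity-between G G′ N A+L<N N≤A′+L′ =
  generator-upper G′ N N≤A′+L′ , generator-lower G N A+L<N

complexity-zero : ∀ {u A} → Generator u 0 A → ∀ N → N ≤ A + 0 → IsLinearComplexity u N 0
complexity-zero G N N≤A = generator-upper G N N≤A , λ _ _ → z≤n

-- The binomial transform (B e) n = Σ_j C(n, j) e j over F₂, defined by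
-- Pascal's rule.
binomial : (ℕ → Bool) → ℕ → Bool
binomial e zero    = e zero
binomial e (suc n) = binomial e n xor binomial (λ m → e (suc m)) n

binomial-cong : ∀ {e e′} n → (∀ m → e m ≡ e′ m) → binomial e n ≡ binomial e′ n
binomial-cong zero    eq = eq zero
binomial-cong (suc n) eq = cong₂ _xor_ (binomial-cong n eq) (binomial-cong n (λ m → eq (suc m)))

binomial-zero : ∀ n → binomial (λ _ → false) n ≡ false
binomial-zero zero    = refl
binomial-zero (suc n) = cong₂ _xor_ (binomial-zero n) (binomial-zero n)

binomial-xor : ∀ e e′ n → binomial (λ m → e m xor e′ m) n ≡ binomial e n xor binomial e′ n
binomial-xor e e′ zero    = refl
binomial-xor e e′ (suc n) =
  trans (cong₂ _xor_ (binomial-xor e e′ n) (binomial-xor (λ m → e (suc m)) (λ m → e′ (suc m)) n))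
        (xor-interchange (binomial e n) (binomial e′ n) _ _)

binomial-scale : ∀ b e n → binomial (λ m → b ∧ e m) n ≡ b ∧ binomial e n
binomial-scale b e zero    = refl
binomial-scale b e (suc n) =
  trans (cong₂ _xor_ (binomial-scale b e n) (binomial-scale b (λ m → e (suc m)) n))
        (sym (∧-distribˡ-xor b _ _))

binomial-triangular : ∀ n e → (∀ m → m < n → e m ≡ false) → binomial e n ≡ e n
binomial-triangular zero    e _    = refl
binomial-triangular (suc n) e e≡0 =
  cong₂ _xor_ (trans (binomial-triangular n e (λ m m<n → e≡0 m (m<n⇒m<1+n m<n))) (e≡0 n ≤-refl))
              (binomial-triangular n _ (λ m m<n → e≡0 (suc m) (s≤s m<n)))

-- Lucas' theorem for the last binary digit: C(2t, j) is odd iff j = 2i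
-- with C(t, i) odd, and C(2t+1, j) is odd iff C(t, ⌊j/2⌋) is odd.
binomial-even : ∀ t e → binomial e (t + t) ≡ binomial (λ x → e (x + x)) t
binomial-odd  : ∀ t e → binomial e (suc (t + t)) ≡
                binomial (λ x → e (x + x)) t xor binomial (λ x → e (suc (x + x))) t

binomial-even zero    e = refl
binomial-even (suc t) e = begin
  binomial e (suc t + suc t)
    ≡⟨ cong (binomial e) (cong suc (+-suc t t)) ⟩
  binomial e (suc (t + t)) xor binomial (λ m → e (suc m)) (suc (t + t))
    ≡⟨ cong₂ _xor_ (binomial-odd t e) (binomial-odd t (λ m → e (suc m))) ⟩
  (E₀ xor E₁) xor (E₁ xor binomial (λ x → e (suc (suc (x + x)))) t)
    ≡⟨ cancel E₀ E₁ _ ⟩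
  E₀ xor binomial (λ x → e (suc (suc (x + x)))) t
    ≡⟨ cong (E₀ xor_) (binomial-cong t (λ m → cong e (cong suc (sym (+-suc m m))))) ⟩
  E₀ xor binomial (λ x → e (suc x + suc x)) t ∎
  where
  open ≡-Reasoning
  E₀ E₁ : Bool
  E₀ = binomial (λ x → e (x + x)) t
  E₁ = binomial (λ x → e (suc (x + x))) t
  cancel : ∀ x y z → (x xor y) xor (y xor z) ≡ x xor z
  cancel = solve 3 (λ x y z → (x :+ y) :+ (y :+ z) := x :+ z) refl
    where open xor-∧-Solver

binomial-odd t e = cong₂ _xor_ (binomial-even t e) (binomial-even t (λ m → e (suc m)))

-- times-x+1 q = (x + 1) q, and translate p = p (x + 1) by Horner's scheme.
times-x+1 : Poly → Poly
times-x+1 q = (false ∷ q) ⊕ q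

translate : Poly → Poly
translate []      = []
translate (b ∷ p) = times-x+1 (translate p) ⊕ (b ∷ [])

Monic-translate : ∀ {n p} → Monic n p → Monic n (translate p)
Monic-translate monic-one = monic-one
Monic-translate (monic-∷ {b = b} {p = p} m) =
  Monic-⊕ (b ∷ [])
    (Monic-⊕ (translate p) (monic-∷ (Monic-translate m)) (≤-reflexive (Monic-length (Monic-translate m))))
    (s≤s z≤n)

-- By Pascal's rule the shift of u = B v is u + B (shift of v): x acting on u
-- corresponds to x + 1 acting on v, so p (x + 1) acting on u corresponds to
-- p acting on v.
translate-⋆-binomial : ∀ u v → (∀ n → u n ≡ binomial v n) →
  ∀ p n → (translate p ⋆ u) n ≡ binomial (p ⋆ v) n
translate-⋆-binomial u v u≡Bv []      n = sym (binomial-zero n)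
translate-⋆-binomial u v u≡Bv (b ∷ p) n = begin
  (translate (b ∷ p) ⋆ u) n
    ≡⟨ ⊕-⋆ (times-x+1 (translate p)) (b ∷ []) u n ⟩
  (times-x+1 (translate p) ⋆ u) n xor ((b ∧ u n) xor false)
    ≡⟨ cong₂ _xor_ (⊕-⋆ (false ∷ translate p) (translate p) u n) (xor-identityʳ (b ∧ u n)) ⟩
  ((false xor (translate p ⋆ u) (suc n)) xor (translate p ⋆ u) n) xor (b ∧ u n)
    ≡⟨ cong₂ (λ x y → (x xor y) xor (b ∧ u n)) (IH (suc n)) (IH n) ⟩
  ((Bpv n xor Bpv′ n) xor Bpv n) xor (b ∧ u n)
    ≡⟨ cancel (Bpv n) (Bpv′ n) (b ∧ u n) ⟩
  (b ∧ u n) xor Bpv′ n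
    ≡⟨ cong (_xor Bpv′ n) (trans (cong (b ∧_) (u≡Bv n)) (sym (binomial-scale b v n))) ⟩
  binomial (λ m → b ∧ v m) n xor Bpv′ n
    ≡⟨ sym (binomial-xor _ _ n) ⟩
  binomial ((b ∷ p) ⋆ v) n ∎
  where
  open ≡-Reasoning
  IH : ∀ n → (translate p ⋆ u) n ≡ binomial (p ⋆ v) n
  IH = translate-⋆-binomial u v u≡Bv p
  Bpv Bpv′ : ℕ → Bool
  Bpv  n = binomial (p ⋆ v) n
  Bpv′ n = binomial (λ m → (p ⋆ v) (suc m)) n
  cancel : ∀ x y z → ((x xor y) xor x) xor z ≡ z xor y
  cancel = solve 3 (λ x y z → ((x :+ y) :+ x) :+ z := z :+ y) refl
    where open xor-∧-Solver

binomial-generator : ∀ {u v L A} → (∀ n → u n ≡ binomial v n) →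
                     Generator v L A → Generator u L A
binomial-generator {u} {v} {L} {A} u≡Bv G = record
  { poly     = translate poly
  ; monic    = Monic-translate monic
  ; vanishes = λ n n<A → trans (translated n) (trans (below n (λ m m<n → vanishes m (<-trans m<n n<A))) (vanishes n n<A))
  ; fails    = trans (translated A) (trans (below A vanishes) fails)
  }
  where
  open Generator G
  translated : ∀ n → (translate poly ⋆ u) n ≡ binomial (poly ⋆ v) n
  translated = translate-⋆-binomial u v u≡Bv poly
  below : ∀ n → (∀ m → m < n → (poly ⋆ v) m ≡ false) → binomial (poly ⋆ v) n ≡ (poly ⋆ v) n
  below n = binomial-triangular n (poly ⋆ v)

data EvenOdd : ℕ → Set where
  even : ∀ t → EvenOdd (t + t)
  odd  : ∀ t → EvenOdd (suc (t + t))

evenOdd : ∀ n → EvenOdd n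
evenOdd zero = even 0
evenOdd (suc n) with evenOdd n
... | even t = odd t
... | odd  t = subst EvenOdd (cong suc (+-suc t t)) (even (suc t))

isOdd : ℕ → Bool
isOdd zero    = false
isOdd (suc n) = not (isOdd n)

isOdd-double : ∀ t → isOdd (t + t) ≡ false
isOdd-double zero    = refl
isOdd-double (suc t) rewrite +-suc t t = trans (not-involutive _) (isOdd-double t)

isOdd-double+1 : ∀ t → isOdd (suc (t + t)) ≡ true
isOdd-double+1 t = cong not (isOdd-double t)

isOdd-half : ∀ m → isOdd ⌊ suc m /2⌋ xor isOdd ⌊ m /2⌋ ≡ isOdd m
isOdd-half zero          = refl
isOdd-half (suc zero)    = refl
isOdd-half (suc (suc m)) =
  trans (xor-annihilates-not (isOdd ⌊ suc m /2⌋) (isOdd ⌊ m /2⌋))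
        (trans (isOdd-half m) (sym (not-involutive (isOdd m))))

⌊double+1/2⌋ : ∀ t → ⌊ suc (t + t) /2⌋ ≡ t
⌊double+1/2⌋ zero = refl
⌊double+1/2⌋ (suc t) rewrite +-suc t t = cong suc (⌊double+1/2⌋ t)

double+1≢double : ∀ t m → ¬ (suc (t + t) ≡ m + m)
double+1≢double t m eq with trans (sym (isOdd-double+1 t)) (trans (cong isOdd eq) (isOdd-double m))
... | ()

double-cancel-≤ : ∀ {t m} → t + t ≤ m + m → t ≤ m
double-cancel-≤ {zero}  {m}     _   = z≤n
double-cancel-≤ {suc t} {zero}  ()
double-cancel-≤ {suc t} {suc m} le rewrite +-suc t t | +-suc m m = s≤s (double-cancel-≤ (≤-pred (≤-pred le)))

suc-double : ∀ t → suc (suc (t + t)) ≡ suc t + suc t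
suc-double t = cong suc (sym (+-suc t t))

-- Squaring over F₂: p² = p (x²).
square : Poly → Poly
square = spread 1

Monic-square : ∀ {n p} → Monic n p → Monic (n + n) (square p)
Monic-square {n} {p} m =
  subst (λ d → Monic d (square p)) (trans (*-comm n 2) (cong (n +_) (+-identityʳ n))) (Monic-spread 1 m)

-- The constant term, which controls the odd positions of a square.
constant : Poly → Bool
constant []      = false
constant (b ∷ _) = b

constant-square : ∀ p → constant (square p) ≡ constant p
constant-square []          = refl
constant-square (b ∷ [])    = refl
constant-square (b ∷ c ∷ p) = refl

constant-⊕ : ∀ p q → constant (p ⊕ q) ≡ constant p xor constant q
constant-⊕ []      q       = refl
constant-⊕ (a ∷ p) []      = sym (xor-identityʳ a)
constant-⊕ (a ∷ p) (b ∷ q) = refl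

-- Annihilating polynomials for the indicator f of the powers of two,
-- characterised by f 0 = 0, f (2t) = f t, f 1 = 1 and f (2t + 3) = 0.
-- For every n we construct a monic D of degree n with (D ⋆ f) j = 0 for
-- 1 ≤ j ≤ n and (D ⋆ f) (n + 1) = 1.  They are differences D = U (n + 1) + U n
-- of approximants U m, which are built by the doubling rules
--   U (2m) = x · U m²     and     U (2m + 1) = U (m + 1)² + U m².
module PowerOfTwo (f : ℕ → Bool) (f-zero : f 0 ≡ false) (f-double : ∀ t → f (t + t) ≡ f t)
                  (f-one : f 1 ≡ true) (f-odd : ∀ t → f (suc (suc t + suc t)) ≡ false) where

  double-as-product : ∀ t → t * 2 + 0 ≡ t + t
  double-as-product = solve-∀

  double+1-as-product : ∀ t → t * 2 + 1 ≡ suc (t + t)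
  double+1-as-product = solve-∀

  square-⋆-even : ∀ p t → (square p ⋆ f) (t + t) ≡ (p ⋆ f) t
  square-⋆-even p t =
    trans (cong (square p ⋆ f) (sym (double-as-product t)))
          (spread-⋆ 1 p f f 0 (λ x → trans (sym (f-double x)) (cong f (sym (double-as-product x)))) t)

  square-⋆-odd : ∀ p t → (square p ⋆ f) (suc (t + t)) ≡ (p ⋆ (λ x → f (suc (x + x)))) t
  square-⋆-odd p t =
    trans (cong (square p ⋆ f) (sym (double+1-as-product t)))
          (spread-⋆ 1 p f (λ x → f (suc (x + x))) 1 (λ x → cong f (sym (double+1-as-product x))) t)

  square-⋆-one : ∀ p → (square p ⋆ f) 1 ≡ constant p
  square-⋆-one p = trans (square-⋆-odd p 0) (at-origin p)
    where
    at-origin : ∀ p → (p ⋆ (λ x → f (suc (x + x)))) 0 ≡ constant p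
    at-origin []      = refl
    at-origin (b ∷ p) =
      trans (cong₂ (λ x y → (b ∧ x) xor y) f-one (⋆-vanishes p 1 (λ { (suc m) _ → f-odd m })))
            (trans (xor-identityʳ (b ∧ true)) (∧-identityʳ b))

  square-⋆-odd-vanishes : ∀ p t → (square p ⋆ f) (suc (suc t + suc t)) ≡ false
  square-⋆-odd-vanishes p t =
    trans (square-⋆-odd p (suc t)) (⋆-vanishes p (suc t) (λ { (suc m) _ → f-odd m }))

  -- An approximant of order n ≥ 1: a monic U of degree n − 1 with
  -- (U ⋆ f) j = 0 for 2 ≤ j ≤ n and (U ⋆ f) (n + 1) = 1.  The remaining
  -- fields are the data needed to double the order.
  record Approximant (n : ℕ) (U : Poly) : Set where
    field
      monic     : Monic (pred n) U
      constant≡ : constant U ≡ isOdd n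
      at-zero   : (U ⋆ f) 0 ≡ isOdd ⌊ n /2⌋
      at-one    : (U ⋆ f) 1 ≡ true
      vanishes  : ∀ j → 2 ≤ j → j ≤ n → (U ⋆ f) j ≡ false
      at-top    : (U ⋆ f) (suc n) ≡ true

  approximant-one : Approximant 1 (true ∷ [])
  approximant-one = record
    { monic     = monic-one
    ; constant≡ = refl
    ; at-zero   = trans (xor-identityʳ (f 0)) f-zero
    ; at-one    = trans (xor-identityʳ (f 1)) f-one
    ; vanishes  = λ { j (s≤s (s≤s _)) (s≤s ()) }
    ; at-top    = trans (xor-identityʳ (f 2)) (trans (f-double 1) f-one)
    }

  approximant-double : ∀ {m U} → 1 ≤ m → Approximant m U → Approximant (m + m) (false ∷ square U)
  approximant-double {m@(suc m′)} {U} _ A = record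
    { monic     = subst (λ d → Monic d (false ∷ square U)) (sym (+-suc m′ m′)) (monic-∷ (Monic-square A.monic))
    ; constant≡ = sym (isOdd-double m)
    ; at-zero   = trans (square-⋆-one U) (trans A.constant≡ (cong isOdd (n≡⌊n+n/2⌋ m)))
    ; at-one    = trans (square-⋆-even U 1) A.at-one
    ; vanishes  = vanishes
    ; at-top    = trans (cong (square U ⋆ f) (suc-double m)) (trans (square-⋆-even U (suc m)) A.at-top)
    }
    where
    module A = Approximant A
    vanishes : ∀ j → 2 ≤ j → j ≤ m + m → (square U ⋆ f) (suc j) ≡ false
    vanishes j 2≤j j≤2m with evenOdd j
    ... | even zero    = ⊥-elim (<⇒≱ 2≤j z≤n)
    ... | even (suc t) = square-⋆-odd-vanishes U t
    ... | odd zero     = ⊥-elim (<⇒≱ 2≤j (s≤s z≤n))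
    ... | odd (suc t)  =
      trans (cong (square U ⋆ f) (suc-double (suc t)))
            (trans (square-⋆-even U (suc (suc t))) (A.vanishes (suc (suc t)) (s≤s (s≤s z≤n)) (double-cancel-≤ t+1≤m)))
      where
      t+1≤m : suc (suc t) + suc (suc t) ≤ m + m
      t+1≤m = subst (_≤ m + m) (suc-double (suc t)) (≤∧≢⇒< j≤2m (double+1≢double (suc t) m))

  approximant-double+1 : ∀ {m U V} → 1 ≤ m → Approximant m U → Approximant (suc m) V →
                         Approximant (suc (m + m)) (square V ⊕ square U)
  approximant-double+1 {m@(suc m′)} {U} {V} _ A B = record
    { monic     = Monic-⊕ (square U) (Monic-square B.monic)
                    (≤-trans (≤-reflexive (Monic-length (Monic-square A.monic))) (s≤s (+-monoʳ-≤ m′ (n≤1+n m′))))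
    ; constant≡ = trans (constant-⊕ (square V) (square U))
                    (trans (cong₂ _xor_ (trans (constant-square V) B.constant≡) (trans (constant-square U) A.constant≡))
                      (trans (xor-inverseˡ (isOdd m)) (sym (isOdd-double+1 m))))
    ; at-zero   = trans (sum 0) (trans (cong₂ _xor_ (trans (square-⋆-even V 0) B.at-zero) (trans (square-⋆-even U 0) A.at-zero))
                    (trans (isOdd-half m) (cong isOdd (sym (⌊double+1/2⌋ m)))))
    ; at-one    = trans (sum 1) (trans (cong₂ _xor_ (trans (square-⋆-one V) B.constant≡) (trans (square-⋆-one U) A.constant≡))
                    (xor-inverseˡ (isOdd m)))
    ; vanishes  = vanishes
    ; at-top    = trans (sum (suc (suc (m + m))))
                    (trans (cong₂ _xor_ (trans (cong (square V ⋆ f) (suc-double m)) (square-⋆-even V (suc m)))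
                                        (trans (cong (square U ⋆ f) (suc-double m)) (square-⋆-even U (suc m))))
                      (cong₂ _xor_ (B.vanishes (suc m) (s≤s (s≤s z≤n)) ≤-refl) A.at-top))
    }
    where
    module A = Approximant A
    module B = Approximant B
    sum : ∀ j → ((square V ⊕ square U) ⋆ f) j ≡ (square V ⋆ f) j xor (square U ⋆ f) j
    sum = ⊕-⋆ (square V) (square U) f
    vanishes : ∀ j → 2 ≤ j → j ≤ suc (m + m) → ((square V ⊕ square U) ⋆ f) j ≡ false
    vanishes j 2≤j j≤2m+1 with evenOdd j
    ... | even zero          = ⊥-elim (<⇒≱ 2≤j z≤n)
    ... | even (suc zero)    =
      trans (sum 2) (cong₂ _xor_ (trans (square-⋆-even V 1) B.at-one) (trans (square-⋆-even U 1) A.at-one))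
    ... | even (suc (suc t)) =
      trans (sum _) (cong₂ _xor_
        (trans (square-⋆-even V (suc (suc t))) (B.vanishes _ (s≤s (s≤s z≤n)) (≤-trans t+2≤m (n≤1+n m))))
        (trans (square-⋆-even U (suc (suc t))) (A.vanishes _ (s≤s (s≤s z≤n)) t+2≤m)))
      where
      t+2≤m : suc (suc t) ≤ m
      t+2≤m = double-cancel-≤ (≤-pred (≤∧≢⇒< j≤2m+1 (λ eq → double+1≢double m (suc (suc t)) (sym eq))))
    ... | odd zero           = ⊥-elim (<⇒≱ 2≤j (s≤s z≤n))
    ... | odd (suc t)        =
      trans (sum _) (cong₂ _xor_ (square-⋆-odd-vanishes V t) (square-⋆-odd-vanishes U t))

  ApproximantPair : ℕ → Set
  ApproximantPair m = Σ Poly (Approximant (suc m)) × Σ Poly (Approximant (suc (suc m)))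

  reindex : ∀ {m n U} → m ≡ n → Approximant m U → Approximant n U
  reindex refl A = A

  approximant-pair : ∀ m → ApproximantPair m
  approximant-pair = <-rec ApproximantPair step
    where
    1≤ : ∀ {t} → 1 ≤ suc t
    1≤ = s≤s z≤n
    step : ∀ m → (∀ {t} → t < m → ApproximantPair t) → ApproximantPair m
    step m IH with evenOdd m
    ... | even zero    = (_ , approximant-one) , (_ , approximant-double 1≤ approximant-one)
    ... | even (suc t) with IH {t} (s≤s (m≤m+n t (suc t)))
    ...   | (_ , A) , (_ , B) =
      (_ , approximant-double+1 1≤ A B) ,
      (_ , reindex (sym (suc-double (suc t))) (approximant-double 1≤ B))
    step m IH | odd t with IH {t} (s≤s (m≤m+n t t))
    ...   | (_ , A) , (_ , B) =
      (_ , reindex (cong suc (+-suc t t)) (approximant-double 1≤ A)) ,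
      (_ , reindex (cong (λ n → suc (suc n)) (+-suc t t)) (approximant-double+1 1≤ A B))

  record Annihilator (n : ℕ) : Set where
    field
      poly     : Poly
      monic    : Monic n poly
      vanishes : ∀ j → 1 ≤ j → j ≤ n → (poly ⋆ f) j ≡ false
      at-zero  : (poly ⋆ f) 0 ≡ isOdd n
      at-top   : (poly ⋆ f) (suc n) ≡ true

  annihilator : ∀ n → Annihilator n
  annihilator zero = record
    { poly     = true ∷ []
    ; monic    = monic-one
    ; vanishes = λ { (suc j) _ () }
    ; at-zero  = trans (xor-identityʳ (f 0)) f-zero
    ; at-top   = trans (xor-identityʳ (f 1)) f-one
    }
  annihilator (suc n) with approximant-pair n
  ... | (U , A) , (V , B) = record
    { poly     = V ⊕ U
    ; monic    = Monic-⊕ U B.monic (≤-reflexive (Monic-length A.monic))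
    ; vanishes = vanishes
    ; at-zero  = trans (sum 0) (trans (cong₂ _xor_ B.at-zero A.at-zero) (isOdd-half (suc n)))
    ; at-top   = trans (sum _) (cong₂ _xor_ (B.vanishes (suc (suc n)) (s≤s (s≤s z≤n)) ≤-refl) A.at-top)
    }
    where
    module A = Approximant A
    module B = Approximant B
    sum : ∀ j → ((V ⊕ U) ⋆ f) j ≡ (V ⋆ f) j xor (U ⋆ f) j
    sum = ⊕-⋆ V U f
    vanishes : ∀ j → 1 ≤ j → j ≤ suc n → ((V ⊕ U) ⋆ f) j ≡ false
    vanishes (suc zero)    _ _   = trans (sum 1) (cong₂ _xor_ B.at-one A.at-one)
    vanishes (suc (suc j)) _ j≤n =
      trans (sum _) (cong₂ _xor_ (B.vanishes _ (s≤s (s≤s z≤n)) (≤-trans j≤n (n≤1+n _)))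
                                 (A.vanishes _ (s≤s (s≤s z≤n)) j≤n))

remainder-unique : ∀ ρ q d .{{_ : NonZero d}} → ρ < d → (ρ + q * d) % d ≡ ρ
remainder-unique ρ q d ρ<d = trans ([m+kn]%n≡m%n ρ q d) (m<n⇒m%n≡m ρ<d)

quotient-unique : ∀ ρ q d .{{_ : NonZero d}} → ρ < d → (ρ + q * d) / d ≡ q
quotient-unique ρ q d ρ<d =
  trans (+-distrib-/ ρ (q * d) remainders<d) (cong₂ _+_ (m<n⇒m/n≡0 ρ<d) (m*n/n≡m q d))
  where
  remainders<d : ρ % d + (q * d) % d < d
  remainders<d = subst (_< d) (sym (trans (cong₂ _+_ (m<n⇒m%n≡m ρ<d) (m*n%n≡0 q d)) (+-identityʳ ρ))) ρ<d

≟-true : ∀ {a b} → a ≡ b → ⌊ a ≟ b ⌋ ≡ true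
≟-true {a} {b} eq = trans (isYes≗does (a ≟ b)) (dec-true (a ≟ b) eq)

≟-false : ∀ {a b} → ¬ (a ≡ b) → ⌊ a ≟ b ⌋ ≡ false
≟-false {a} {b} ne = trans (isYes≗does (a ≟ b)) (dec-false (a ≟ b) ne)

≟-sound : ∀ {a b} → ⌊ a ≟ b ⌋ ≡ true → a ≡ b
≟-sound eq = toWitness (subst T (sym eq) tt)

≟-double+1 : ∀ a b → ⌊ suc (a + a) ≟ suc (b + b) ⌋ ≡ ⌊ a ≟ b ⌋
≟-double+1 a b with a ≟ b
... | yes a≡b = ≟-true (cong (λ x → suc (x + x)) a≡b)
... | no  a≢b = ≟-false (λ eq → a≢b (≤-antisym (double-cancel-≤ (≤-reflexive (suc-injective eq)))
                                                (double-cancel-≤ (≤-reflexive (sym (suc-injective eq))))))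

suc-2^j∸1 : ∀ j → suc (2 ^ j ∸ 1) ≡ 2 ^ j
suc-2^j∸1 j = trans (+-comm 1 (2 ^ j ∸ 1)) (m∸n+n≡m (m^n>0 2 j))

2^[1+j]∸1 : ∀ j → 2 ^ suc j ∸ 1 ≡ suc ((2 ^ j ∸ 1) + (2 ^ j ∸ 1))
2^[1+j]∸1 j =
  trans (cong (λ x → x + (x + 0) ∸ 1) (sym (suc-2^j∸1 j)))
        (trans (cong (h +_) (+-identityʳ (suc h))) (+-suc h h))
  where
  h : ℕ
  h = 2 ^ j ∸ 1

endsInOnes : ℕ → ℕ → Bool
endsInOnes j n = ⌊ _%_ n (2 ^ j) {{2^k-nonZero j}} ≟ 2 ^ j ∸ 1 ⌋

%-append-digit : ∀ j b t → b ≤ 1 →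
  _%_ (b + (t + t)) (2 ^ suc j) {{2^k-nonZero (suc j)}} ≡
  b + (_%_ t (2 ^ j) {{2^k-nonZero j}} + _%_ t (2 ^ j) {{2^k-nonZero j}})
%-append-digit j b t b≤1 =
  trans (cong (_% (2 ^ suc j)) expand) (remainder-unique (b + (ρ + ρ)) q (2 ^ suc j) bound)
  where
  instance _ = 2^k-nonZero j
  instance _ = 2^k-nonZero (suc j)
  M ρ q : ℕ
  M = 2 ^ j
  ρ = t % M
  q = t / M
  double-expansion : ∀ b ρ q M → b + ((ρ + q * M) + (ρ + q * M)) ≡ (b + (ρ + ρ)) + q * (2 * M)
  double-expansion = solve-∀
  expand : b + (t + t) ≡ (b + (ρ + ρ)) + q * (2 ^ suc j)
  expand = trans (cong (λ x → b + (x + x)) (m≡m%n+[m/n]*n t M)) (double-expansion b ρ q M)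
  bound : b + (ρ + ρ) < 2 ^ suc j
  bound = begin-strict
    b + (ρ + ρ)   ≤⟨ +-monoˡ-≤ (ρ + ρ) b≤1 ⟩
    suc (ρ + ρ)   <⟨ s≤s (≤-reflexive (sym (+-suc ρ ρ))) ⟩
    suc ρ + suc ρ ≤⟨ +-mono-≤ (m%n<n t M) (m%n<n t M) ⟩
    M + M         ≡⟨ cong (M +_) (sym (+-identityʳ M)) ⟩
    2 ^ suc j     ∎
    where open ≤-Reasoning

endsInOnes-double : ∀ j t → endsInOnes (suc j) (t + t) ≡ false
endsInOnes-double j t =
  trans (cong₂ (λ x y → ⌊ x ≟ y ⌋) (%-append-digit j 0 t z≤n) (2^[1+j]∸1 j))
        (≟-false (λ eq → double+1≢double (2 ^ j ∸ 1) (_%_ t (2 ^ j) {{2^k-nonZero j}}) (sym eq)))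

endsInOnes-double+1 : ∀ j t → endsInOnes (suc j) (suc (t + t)) ≡ endsInOnes j t
endsInOnes-double+1 j t =
  trans (cong₂ (λ x y → ⌊ x ≟ y ⌋) (%-append-digit j 1 t ≤-refl) (2^[1+j]∸1 j))
        (≟-double+1 _ _)

column : ℕ → ℕ → Bool
column j x = ⌊ x ≟ 2 ^ j ∸ 1 ⌋

column-double : ∀ j x → column (suc j) (x + x) ≡ false
column-double j x =
  trans (cong (λ y → ⌊ x + x ≟ y ⌋) (2^[1+j]∸1 j)) (≟-false (λ eq → double+1≢double (2 ^ j ∸ 1) x (sym eq)))

column-double+1 : ∀ j x → column (suc j) (suc (x + x)) ≡ column j x
column-double+1 j x = trans (cong (λ y → ⌊ suc (x + x) ≟ y ⌋) (2^[1+j]∸1 j)) (≟-double+1 x _)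

-- Lucas' theorem for the column 2^j − 1 of Pascal's triangle mod 2:
-- C(t, 2^j − 1) is odd iff t ≡ 2^j − 1 (mod 2^j).
lucas : ∀ j t → binomial (column j) t ≡ endsInOnes j t
lucas zero    t = trans (column-zero t) (sym (≟-true (n%1≡0 t)))
  where
  column-zero : ∀ t → binomial (column 0) t ≡ true
  column-zero zero    = refl
  column-zero (suc t) = cong₂ _xor_ (column-zero t) (binomial-zero t)
lucas (suc j) t with evenOdd t
... | even u = begin
  binomial (column (suc j)) (u + u)                 ≡⟨ binomial-even u (column (suc j)) ⟩
  binomial (λ x → column (suc j) (x + x)) u         ≡⟨ binomial-cong u (column-double j) ⟩
  binomial (λ _ → false) u                          ≡⟨ binomial-zero u ⟩
  false                                             ≡⟨ sym (endsInOnes-double j u) ⟩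
  endsInOnes (suc j) (u + u)                        ∎
  where open ≡-Reasoning
... | odd u = begin
  binomial (column (suc j)) (suc (u + u))
    ≡⟨ binomial-odd u (column (suc j)) ⟩
  binomial (λ x → column (suc j) (x + x)) u xor binomial (λ x → column (suc j) (suc (x + x))) u
    ≡⟨ cong₂ _xor_ (trans (binomial-cong u (column-double j)) (binomial-zero u))
                   (trans (binomial-cong u (column-double+1 j)) (lucas j u)) ⟩
  endsInOnes j u
    ≡⟨ sym (endsInOnes-double+1 j u) ⟩
  endsInOnes (suc j) (suc (u + u)) ∎
  where open ≡-Reasoning

n/2≡⌊n/2⌋ : ∀ n → n / 2 ≡ ⌊ n /2⌋
n/2≡⌊n/2⌋ n with evenOdd n
... | even t = trans (cong (_/ 2) (double≡*2 t)) (trans (quotient-unique 0 t 2 (s≤s z≤n)) (n≡⌊n+n/2⌋ t))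
  where
  double≡*2 : ∀ t → t + t ≡ 0 + t * 2
  double≡*2 = solve-∀
... | odd t  = trans (cong (_/ 2) (double+1≡*2 t)) (trans (quotient-unique 1 t 2 ≤-refl) (sym (⌊double+1/2⌋ t)))
  where
  double+1≡*2 : ∀ t → suc (t + t) ≡ 1 + t * 2
  double+1≡*2 = solve-∀

module BlockSequence (k′ : ℕ) where
  k h K : ℕ
  k = suc k′
  h = 2 ^ k′ ∸ 1
  K = suc (h + h)

  2^k∸1≡K : 2 ^ k ∸ 1 ≡ K
  2^k∸1≡K = 2^[1+j]∸1 k′

  sFuel : ℕ → ℕ → Bool
  sFuel zero       n = false
  sFuel (suc fuel) n = if isOdd n then ⌊ n ≟ K ⌋ else sFuel fuel ⌊ n /2⌋

  s : ℕ → Bool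
  s n = sFuel (suc n) n

  sFuel-zero : ∀ fuel → sFuel fuel 0 ≡ false
  sFuel-zero zero       = refl
  sFuel-zero (suc fuel) = sFuel-zero fuel

  sFuel-irrelevant : ∀ fuel fuel′ n → n < fuel → n < fuel′ → sFuel fuel n ≡ sFuel fuel′ n
  sFuel-irrelevant (suc fuel) (suc fuel′) zero    _           _ =
    trans (sFuel-zero fuel) (sym (sFuel-zero fuel′))
  sFuel-irrelevant (suc fuel) (suc fuel′) (suc m) (s≤s m<fuel) (s≤s m<fuel′) =
    cong (if isOdd (suc m) then ⌊ suc m ≟ K ⌋ else_)
         (sFuel-irrelevant fuel fuel′ ⌊ suc m /2⌋ (<-≤-trans (⌊n/2⌋<n m) m<fuel) (<-≤-trans (⌊n/2⌋<n m) m<fuel′))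

  s-double : ∀ t → s (t + t) ≡ s t
  s-double zero    = refl
  s-double (suc t) rewrite isOdd-double (suc t) =
    trans (cong (sFuel (suc t + suc t)) (sym (n≡⌊n+n/2⌋ (suc t))))
          (sFuel-irrelevant (suc t + suc t) (suc (suc t)) (suc t) (s≤s (m≤n+m (suc t) t)) ≤-refl)

  s-odd : ∀ n → isOdd n ≡ true → s n ≡ ⌊ n ≟ K ⌋
  s-odd zero    ()
  s-odd (suc n) n-odd rewrite n-odd = refl

  s-double+1 : ∀ t → s (suc (t + t)) ≡ column k′ t
  s-double+1 t = trans (s-odd _ (isOdd-double+1 t)) (≟-double+1 t h)

  -- B s satisfies the defining recursion of r.
  binomial-s-halving : ∀ n → binomial s n ≡ endsInOnes k n xor binomial s ⌊ n /2⌋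
  binomial-s-halving n with evenOdd n
  ... | even t = begin
    binomial s (t + t)                     ≡⟨ binomial-even t s ⟩
    binomial (λ x → s (x + x)) t           ≡⟨ binomial-cong t s-double ⟩
    binomial s t                           ≡⟨ cong (binomial s) (n≡⌊n+n/2⌋ t) ⟩
    binomial s ⌊ t + t /2⌋                 ≡⟨ cong (_xor binomial s ⌊ t + t /2⌋) (sym (endsInOnes-double k′ t)) ⟩
    endsInOnes k (t + t) xor binomial s ⌊ t + t /2⌋ ∎
    where open ≡-Reasoning
  ... | odd t = begin
    binomial s (suc (t + t))
      ≡⟨ binomial-odd t s ⟩
    binomial (λ x → s (x + x)) t xor binomial (λ x → s (suc (x + x))) t
      ≡⟨ cong₂ _xor_ (binomial-cong t s-double) (trans (binomial-cong t s-double+1) (lucas k′ t)) ⟩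
    binomial s t xor endsInOnes k′ t
      ≡⟨ xor-comm (binomial s t) _ ⟩
    endsInOnes k′ t xor binomial s t
      ≡⟨ cong₂ _xor_ (sym (endsInOnes-double+1 k′ t)) (cong (binomial s) (sym (⌊double+1/2⌋ t))) ⟩
    endsInOnes k (suc (t + t)) xor binomial s ⌊ suc (t + t) /2⌋ ∎
    where open ≡-Reasoning

  r≡binomial-s : ∀ n → r k n ≡ binomial s n
  r≡binomial-s n = rFuel≡ n n ≤-refl
    where
    rFuel≡ : ∀ fuel n → n ≤ fuel → rFuel k fuel n ≡ binomial s n
    rFuel≡ zero       zero    _         = refl
    rFuel≡ (suc fuel) zero    _         = refl
    rFuel≡ (suc fuel) (suc m) (s≤s m≤fuel) =
      trans (cong (endsInOnes k (suc m) xor_)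
                  (trans (cong (rFuel k fuel) (n/2≡⌊n/2⌋ (suc m)))
                         (rFuel≡ fuel ⌊ suc m /2⌋ (≤-trans (≤-pred (⌊n/2⌋<n m)) m≤fuel))))
            (sym (binomial-s-halving (suc m)))

  s-support : ∀ n → s n ≡ true → Σ ℕ λ t → n ≡ t * K
  s-support = <-rec (λ n → s n ≡ true → Σ ℕ λ t → n ≡ t * K) step
    where
    step : ∀ n → (∀ {m} → m < n → s m ≡ true → Σ ℕ λ t → m ≡ t * K) →
           s n ≡ true → Σ ℕ λ t → n ≡ t * K
    step n IH sn with evenOdd n
    step _ IH () | even zero
    ... | even (suc t) with IH (s≤s (m≤n+m (suc t) t)) (trans (sym (s-double (suc t))) sn)
    ...   | u , t+1≡uK = (u + u) , trans (cong₂ _+_ t+1≡uK t+1≡uK) (sym (*-distribʳ-+ K u u))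
    step _ IH sn | odd t = 1 , trans (≟-sound (trans (sym (s-odd _ (isOdd-double+1 t))) sn)) (sym (+-identityʳ K))

  s-off-multiples : ∀ t ρ → 0 < ρ → ρ < K → s (t * K + ρ) ≡ false
  s-off-multiples t ρ 0<ρ ρ<K with s (t * K + ρ) in sn
  ... | false = refl
  ... | true with s-support (t * K + ρ) sn
  ...   | u , eq = ⊥-elim (<⇒≢ 0<ρ (sym ρ≡0))
    where
    ρ≡0 : ρ ≡ 0
    ρ≡0 = begin
      ρ                    ≡⟨ sym (remainder-unique ρ t K ρ<K) ⟩
      (ρ + t * K) % K      ≡⟨ cong (_% K) (trans (+-comm ρ (t * K)) eq) ⟩
      (u * K) % K          ≡⟨ remainder-unique 0 u K (s≤s z≤n) ⟩
      0                    ∎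
      where open ≡-Reasoning

  -- Along the multiples of K, s is the indicator of the powers of two.
  f : ℕ → Bool
  f t = s (t * K)

  f-double : ∀ t → f (t + t) ≡ f t
  f-double t = trans (cong s (*-distribʳ-+ K t t)) (s-double (t * K))

  f-one : f 1 ≡ true
  f-one = trans (cong s (+-identityʳ K)) (trans (s-odd K (isOdd-double+1 h)) (≟-true refl))

  f-odd : ∀ t → f (suc (suc t + suc t)) ≡ false
  f-odd t = trans (cong s (as-odd t h)) (trans (s-double+1 X) (≟-false X≢h))
    where
    X : ℕ
    X = suc t * K + h
    as-odd : ∀ t h → suc (suc t + suc t) * suc (h + h) ≡ suc ((suc t * suc (h + h) + h) + (suc t * suc (h + h) + h))
    as-odd = solve-∀
    X≢h : ¬ (X ≡ h)
    X≢h eq = <⇒≢ h<X (sym eq)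
      where
      h<X : h < X
      h<X = ≤-trans (s≤s (m≤m+n h h)) (≤-trans (m≤m+n K (t * K)) (m≤m+n (suc t * K) h))

  open PowerOfTwo f refl f-double f-one f-odd using (Annihilator; annihilator)

  data Position (m : ℕ) : Set where
    multiple : ∀ i → m ≡ i * K → Position m
    between  : ∀ i ρ → 0 < ρ → ρ < K → m ≡ i * K + ρ → Position m

  position : ∀ m → Position m
  position m with m % K in m%K
  ... | zero  = multiple (m / K) (trans (m≡m%n+[m/n]*n m K) (cong (_+ (m / K) * K) m%K))
  ... | suc ρ = between (m / K) (suc ρ) (s≤s z≤n) (subst (_< K) m%K (m%n<n m K))
                  (trans (m≡m%n+[m/n]*n m K) (trans (cong (_+ (m / K) * K) m%K) (+-comm (suc ρ) _)))

  -- S n = D n (x^K), the annihilator of f spread along the multiples of K.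
  D : ℕ → Poly
  D n = Annihilator.poly (annihilator n)

  S : ℕ → Poly
  S n = spread (h + h) (D n)

  S-at-multiple : ∀ n i → (S n ⋆ s) (i * K) ≡ (D n ⋆ f) i
  S-at-multiple n i =
    trans (cong (S n ⋆ s) (sym (+-identityʳ (i * K))))
          (spread-⋆ (h + h) (D n) s f 0 (λ t → cong s (sym (+-identityʳ (t * K)))) i)

  S-between : ∀ n i ρ → 0 < ρ → ρ < K → (S n ⋆ s) (i * K + ρ) ≡ false
  S-between n i ρ 0<ρ ρ<K =
    trans (spread-⋆ (h + h) (D n) s (λ t → s (t * K + ρ)) ρ (λ t → refl) i)
          (⋆-vanishes (D n) i (λ m _ → s-off-multiples m ρ 0<ρ ρ<K))

  S-vanishes : ∀ n m → 1 ≤ m → m < suc n * K → (S n ⋆ s) m ≡ false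
  S-vanishes n m 1≤m m<[n+1]K with position m
  ... | between i ρ 0<ρ ρ<K m≡ = trans (cong (S n ⋆ s) m≡) (S-between n i ρ 0<ρ ρ<K)
  ... | multiple zero    refl  = ⊥-elim (<⇒≱ 1≤m z≤n)
  ... | multiple (suc i) m≡    =
    trans (cong (S n ⋆ s) m≡)
          (trans (S-at-multiple n (suc i))
                 (Annihilator.vanishes (annihilator n) (suc i) (s≤s z≤n)
                   (≤-pred (*-cancelʳ-< K (suc i) (suc n) (subst (_< suc n * K) m≡ m<[n+1]K)))))

  S-at-zero : ∀ n → (S n ⋆ s) 0 ≡ isOdd n
  S-at-zero n = trans (S-at-multiple n 0) (Annihilator.at-zero (annihilator n))

  S-at-top : ∀ n → (S n ⋆ s) (suc n * K) ≡ true
  S-at-top n = trans (S-at-multiple n (suc n)) (Annihilator.at-top (annihilator n))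

  Monic-S : ∀ n → Monic (n * K) (S n)
  Monic-S n = Monic-spread (h + h) (Annihilator.monic (annihilator n))

  even-generator : ∀ q → Generator s ((q + q) * K) (suc (q + q) * K)
  even-generator q = record
    { poly     = S (q + q)
    ; monic    = Monic-S (q + q)
    ; vanishes = vanishes
    ; fails    = S-at-top (q + q)
    }
    where
    vanishes : ∀ m → m < suc (q + q) * K → (S (q + q) ⋆ s) m ≡ false
    vanishes zero    _ = trans (S-at-zero (q + q)) (isOdd-double q)
    vanishes (suc m) m<K = S-vanishes (q + q) (suc m) (s≤s z≤n) m<K

  shifted-generator : ∀ n → Generator s (suc (n * K)) (pred (suc n * K))
  shifted-generator n = record
    { poly     = false ∷ S n
    ; monic    = monic-∷ (Monic-S n)
    ; vanishes = λ m m<A → S-vanishes n (suc m) (s≤s z≤n) (s≤s m<A)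
    ; fails    = S-at-top n
    }

module Complexity (k′ : ℕ) where
  open BlockSequence k′

  r-even-generator : ∀ q → Generator (r k) ((q + q) * K) (suc (q + q) * K)
  r-even-generator q = binomial-generator r≡binomial-s (even-generator q)

  r-odd-generator : ∀ q → Generator (r k) (suc (suc (q + q) * K)) (pred ((suc q + suc q) * K))
  r-odd-generator q =
    subst (λ A → Generator (r k) (suc (suc (q + q) * K)) (pred (A * K))) (suc-double q)
          (binomial-generator r≡binomial-s (shifted-generator (suc (q + q))))

  even-failure : ∀ q → suc (q + q) * K + (q + q) * K ≡ K + q * (4 * K)
  even-failure q = lemma h q
    where
    lemma : ∀ h q → suc (q + q) * suc (h + h) + (q + q) * suc (h + h) ≡ suc (h + h) + q * (4 * suc (h + h))
    lemma = solve-∀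

  odd-failure : ∀ q → pred ((suc q + suc q) * K) + suc (suc (q + q) * K) ≡ (K + K + K) + q * (4 * K)
  odd-failure q = lemma h q
    where
    lemma : ∀ h q → h + h + (q + suc q) * suc (h + h) + suc (suc (q + q) * suc (h + h)) ≡
                    (suc (h + h) + suc (h + h) + suc (h + h)) + q * (4 * suc (h + h))
    lemma = solve-∀

  low-window : ∀ q ρ → ρ ≤ K → IsLinearComplexity (r k) (ρ + q * (4 * K)) ((q + q) * K)
  low-window zero     ρ ρ≤K =
    complexity-zero (r-even-generator 0) (ρ + 0) (+-monoˡ-≤ 0 (subst (ρ ≤_) (sym (+-identityʳ K)) ρ≤K))
  low-window (suc q) ρ ρ≤K =
    complexity-between (r-odd-generator q) (r-even-generator (suc q)) _
      (subst (_< ρ + suc q * (4 * K)) (sym (odd-failure q)) (begin-strict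
        (K + K + K) + q * (4 * K)           <⟨ +-monoˡ-< (q * (4 * K)) 3K<4K ⟩
        4 * K + q * (4 * K)                 ≤⟨ m≤n+m _ ρ ⟩
        ρ + suc q * (4 * K)                 ∎))
      (subst (ρ + suc q * (4 * K) ≤_) (sym (even-failure (suc q))) (+-monoˡ-≤ (suc q * (4 * K)) ρ≤K))
    where
    open ≤-Reasoning
    3K<4K : K + K + K < 4 * K
    3K<4K = subst (K + K + K <_) (solve-three h) (m<m+n (K + K + K) (s≤s z≤n))
      where
      solve-three : ∀ h → suc (h + h) + suc (h + h) + suc (h + h) + suc (h + h) ≡ 4 * suc (h + h)
      solve-three = solve-∀

  odd-window : ∀ q ρ → K < ρ → ρ ≤ K + K + K →
               IsLinearComplexity (r k) (ρ + q * (4 * K)) (suc (suc (q + q) * K))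
  odd-window q ρ K<ρ ρ≤3K =
    complexity-between (r-even-generator q) (r-odd-generator q) _
      (subst (_< ρ + q * (4 * K)) (sym (even-failure q)) (+-monoˡ-< (q * (4 * K)) K<ρ))
      (subst (ρ + q * (4 * K) ≤_) (sym (odd-failure q)) (+-monoˡ-≤ (q * (4 * K)) ρ≤3K))

  high-window : ∀ q ρ → K + K + K < ρ → ρ < 4 * K →
                IsLinearComplexity (r k) (ρ + q * (4 * K)) ((suc q + suc q) * K)
  high-window q ρ 3K<ρ ρ<4K =
    complexity-between (r-odd-generator q) (r-even-generator (suc q)) _
      (subst (_< ρ + q * (4 * K)) (sym (odd-failure q)) (+-monoˡ-< (q * (4 * K)) 3K<ρ))
      (subst (ρ + q * (4 * K) ≤_) (sym (even-failure (suc q)))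
        (≤-trans (+-monoˡ-≤ (q * (4 * K)) (<⇒≤ ρ<4K)) (m≤n+m (suc q * (4 * K)) K)))

  instance
    period-nz : NonZero (period k)
    period-nz = period-nonZero k (s≤s z≤n)

  period≡4K : period k ≡ 4 * K
  period≡4K = cong (4 *_) 2^k∸1≡K

  2^k≡1+K : 2 ^ k ≡ suc K
  2^k≡1+K = trans (sym (suc-2^j∸1 k)) (cong suc 2^k∸1≡K)

  3*[2^k∸1]≡3K : 3 * (2 ^ k ∸ 1) ≡ K + K + K
  3*[2^k∸1]≡3K = trans (cong (3 *_) 2^k∸1≡K) (three K)
    where
    three : ∀ K → 3 * K ≡ K + K + K
    three = solve-∀

  slope : ∀ x → 2 * (2 ^ k ∸ 1) * x ≡ (x + x) * K
  slope x = trans (cong (λ y → 2 * y * x) 2^k∸1≡K) (lemma K x)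
    where
    lemma : ∀ K x → 2 * K * x ≡ (x + x) * K
    lemma = solve-∀

  ≤ᵇ-true : ∀ {m n} → (m ≤ᵇ n) ≡ true → m ≤ n
  ≤ᵇ-true {m} {n} eq = ≤ᵇ⇒≤ m n (subst T (sym eq) _)

  ≤ᵇ-false : ∀ {m n} → (m ≤ᵇ n) ≡ false → n < m
  ≤ᵇ-false eq = ≰⇒> (λ m≤n → subst T eq (≤⇒≤ᵇ m≤n))

  halves : ∀ h → 4 * suc (h + h) ≡ (suc (suc (h + h)) + (h + h)) + (suc (suc (h + h)) + (h + h))
  halves = solve-∀

  module _ (N : ℕ) where
    ρ q : ℕ
    ρ = N % period k
    q = N / period k

    N≡ρ+4qK : N ≡ ρ + q * (4 * K)
    N≡ρ+4qK = trans (m≡m%n+[m/n]*n N (period k)) (cong (λ P → ρ + q * P) period≡4K)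

    ρ<period : ρ < period k
    ρ<period = m%n<n N (period k)

    rounded : N + 2 ^ k ∸ 2 ≡ (ρ + (h + h)) + q * period k
    rounded = begin
      N + 2 ^ k ∸ 2                     ≡⟨ cong (λ y → N + y ∸ 2) 2^k≡1+K ⟩
      N + suc (suc (h + h)) ∸ 2         ≡⟨ cong (_∸ 2) (trans (+-suc N _) (cong suc (+-suc N (h + h)))) ⟩
      N + (h + h)                       ≡⟨ cong (_+ (h + h)) (m≡m%n+[m/n]*n N (period k)) ⟩
      ρ + q * period k + (h + h)        ≡⟨ +-swapʳ ρ (q * period k) (h + h) ⟩
      ρ + (h + h) + q * period k        ∎
      where open ≡-Reasoning

    rounded-quotient-low : ρ ≤ K → (N + 2 ^ k ∸ 2) / period k ≡ q
    rounded-quotient-low ρ≤K =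
      trans (cong (_/ period k) rounded) (quotient-unique (ρ + (h + h)) q (period k) bound)
      where
      bound : ρ + (h + h) < period k
      bound = subst (ρ + (h + h) <_) (sym period≡4K)
                (≤-trans (+-monoˡ-≤ (h + h) (s≤s ρ≤K)) (subst (suc K + (h + h) ≤_) (sym (halves h)) (m≤m+n _ _)))

    rounded-quotient-high : K + K + K < ρ → (N + 2 ^ k ∸ 2) / period k ≡ suc q
    rounded-quotient-high 3K<ρ = begin
      (N + 2 ^ k ∸ 2) / period k                      ≡⟨ cong (_/ period k) rounded ⟩
      (ρ + (h + h) + q * period k) / period k         ≡⟨ cong (λ x → (x + q * period k) / period k) (sym (m∸n+n≡m P≤)) ⟩
      (ρ′ + period k + q * period k) / period k       ≡⟨ cong (_/ period k) (+-assoc ρ′ (period k) (q * period k)) ⟩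
      (ρ′ + suc q * period k) / period k              ≡⟨ quotient-unique ρ′ (suc q) (period k) ρ′<P ⟩
      suc q                                           ∎
      where
      open ≡-Reasoning
      ρ′ : ℕ
      ρ′ = ρ + (h + h) ∸ period k
      P≤ : period k ≤ ρ + (h + h)
      P≤ = subst (_≤ ρ + (h + h)) (trans (four h) (sym period≡4K)) (+-monoˡ-≤ (h + h) 3K<ρ)
        where
        four : ∀ h → suc (suc (h + h) + suc (h + h) + suc (h + h)) + (h + h) ≡ 4 * suc (h + h)
        four = solve-∀
      ρ′<P : ρ′ < period k
      ρ′<P = +-cancelʳ-< (period k) ρ′ (period k)
               (subst (_< period k + period k) (sym (m∸n+n≡m P≤)) (+-mono-< ρ<period (h+h<P)))
        where
        h+h<P : h + h < period k
        h+h<P = subst (h + h <_) (sym period≡4K) (m≤m+n K (3 * K))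

    formula-cases : ∀ b₁ b₂ → b₁ ≡ (2 ^ k ≤ᵇ ρ) → b₂ ≡ (ρ ≤ᵇ 3 * (2 ^ k ∸ 1)) →
      IsLinearComplexity (r k) N
        (if b₁ ∧ b₂ then 2 * (2 ^ k ∸ 1) * q + 2 ^ k
         else 2 * (2 ^ k ∸ 1) * ((N + 2 ^ k ∸ 2) / period k))
    formula-cases true true 2^k≤ρ ρ≤3K =
      subst₂ (IsLinearComplexity (r k)) (sym N≡ρ+4qK) (sym value)
        (odd-window q ρ (subst (_≤ ρ) 2^k≡1+K (≤ᵇ-true (sym 2^k≤ρ)))
                        (subst (ρ ≤_) 3*[2^k∸1]≡3K (≤ᵇ-true (sym ρ≤3K))))
      where
      value : 2 * (2 ^ k ∸ 1) * q + 2 ^ k ≡ suc (suc (q + q) * K)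
      value = trans (cong₂ _+_ (slope q) 2^k≡1+K) (lemma q K)
        where
        lemma : ∀ q K → (q + q) * K + suc K ≡ suc (suc (q + q) * K)
        lemma = solve-∀
    formula-cases true false 2^k≤ρ 3K<ρ =
      subst₂ (IsLinearComplexity (r k)) (sym N≡ρ+4qK)
             (sym (trans (cong (2 * (2 ^ k ∸ 1) *_) (rounded-quotient-high 3K<ρ′)) (slope (suc q))))
             (high-window q ρ 3K<ρ′ (subst (ρ <_) period≡4K ρ<period))
      where
      3K<ρ′ : K + K + K < ρ
      3K<ρ′ = subst (_< ρ) 3*[2^k∸1]≡3K (≤ᵇ-false (sym 3K<ρ))
    formula-cases false b₂ ρ<2^k _ =
      subst₂ (IsLinearComplexity (r k)) (sym N≡ρ+4qK)
             (sym (trans (cong (2 * (2 ^ k ∸ 1) *_) (rounded-quotient-low ρ≤K)) (slope q)))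
             (low-window q ρ ρ≤K)
      where
      ρ≤K : ρ ≤ K
      ρ≤K = ≤-pred (subst (ρ <_) 2^k≡1+K (≤ᵇ-false (sym ρ<2^k)))

-- The closed formula for the linear complexity of r.  Writing N = ρ + 4qK,
-- the tests of the formula select one of the three windows of the staircase.
theorem2 : (k : ℕ) → (k≥1 : 1 ≤ k) → (N : ℕ) → 1 ≤ N →
           IsLinearComplexity (r k) N (LFormula k k≥1 N)
theorem2 (suc k′) (s≤s z≤n) N _ = formula-cases N _ _ refl refl
  where open Complexity k′
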